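{- Let $k\geq 2$ and $n\geq 5$. Then $\gamma_{\times k}(K(n,2))=k+3$ if and only if $n=2k+3$.
   Context: The Kneser graph $K(n,2)$ has as vertices the $2$-subsets of $[n]=\{1,\dots,n\}$, two vertices adjacent iff disjoint. For a vertex $v$, $N[v]$ is its closed neighbourhood. A set $D$ of vertices is a $k$-tuple dominating set if $|N[v]\cap D|\geq k$ for every vertex $v$; $\gamma_{\times k}(K(n,2))$ is the minimum cardinality of such a set (defined when $k\leq\binom{n-2}{2}+1$). -}

module Defs where

open import Data.Nat using (ℕ; _≤_; _+_; _∸_)
open import Data.Nat.Combinatorics using (_C_)
open import Data.Fin using (Fin; _<_; _≟_)
open import Data.Bool using (Bool; true; false; _∧_; _∨_; not; if_then_else_)
open import Data.List using (List; []; _∷_; length)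
open import Data.List.Relation.Unary.Unique.Propositional using (Unique)
open import Data.Product using (Σ; _×_)
open import Relation.Binary.PropositionalEquality using (_≡_)
open import Relation.Nullary.Decidable using (⌊_⌋)

-- A vertex of K(n,2): a 2-subset {a,b} of [n], represented with a < b.
record Vertex (n : ℕ) : Set where
  constructor vtx
  field
    a   : Fin n
    b   : Fin n
    a<b : a < b
open Vertex public

_==_ : ∀ {n} → Fin n → Fin n → Bool
i == j = ⌊ i ≟ j ⌋

sameV : ∀ {n} → Vertex n → Vertex n → Bool
sameV u v = (a u == a v) ∧ (b u == b v)

disjointV : ∀ {n} → Vertex n → Vertex n → Bool
disjointV u v =
  not (a u == a v) ∧ not (a u == b v) ∧ not (b u == a v) ∧ not (b u == b v)

inClosedNbhd : ∀ {n} → Vertex n → Vertex n → Bool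
inClosedNbhd u v = sameV u v ∨ disjointV u v

-- |N[v] ∩ D| for D given as a duplicate-free list of vertices
countNbhd : ∀ {n} → Vertex n → List (Vertex n) → ℕ
countNbhd v [] = 0
countNbhd v (u ∷ D) =
  (if inClosedNbhd u v then 1 else 0) + countNbhd v D

IsKTupleDom : (n k : ℕ) → List (Vertex n) → Set
IsKTupleDom n k D = (v : Vertex n) → k ≤ countNbhd v D

KTupleDomNumberIs : (n k m : ℕ) → Set
KTupleDomNumberIs n k m =
  Σ (List (Vertex n)) (λ D → Unique D × IsKTupleDom n k D × length D ≡ m)
  × ((D : List (Vertex n)) → Unique D → IsKTupleDom n k D → m ≤ length D)

-- the condition under which γ_{×k}(K(n,2)) is defined
KTupleDefined : (n k : ℕ) → Set
KTupleDefined n k = k ≤ ((n ∸ 2) C 2) + 1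

-- Let D be a k-tuple dominating set of K(n,2) with |D| = k + c, and let deg x count the members of D through
-- the point x. At most c members of D lie outside N[v] for v = {x, y}; these are the members other than v
-- meeting v, and there are deg x + deg y - 2[v ∈ D] of them, so deg x + deg y ≤ c + 2[xy ∈ D]. Fix a point x
-- of maximum degree Δ: every other point has degree at most min(Δ, c - Δ) if it is not joined to x in D and
-- min(Δ, c + 2 - Δ) if it is, and summing over all points bounds 2|D|. For c ≤ 3 and n + c ≤ 2k + 5 this
-- bound is violated, so γ ≥ k + 3 when n = 2k + 3 and γ ≠ k + 3 when n ≤ 2k + 2. Conversely, for n = 2k + 3
-- a triangle plus k disjoint pairs is a k-tuple dominating set of size k + 3, and for n ≥ 2k + 4 already
-- k + 2 disjoint pairs are one.
module Submission where

open import Data.Bool using (Bool; true; false; not; _∧_; _∨_; if_then_else_; T)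
open import Data.Empty using (⊥; ⊥-elim)
open import Data.Fin as Fin using (Fin; zero; suc; _≟_)
import Data.Fin.Properties as Finₚ
open import Data.Fin.Patterns using (0F; 1F; 2F)
open import Data.List using (List; []; _∷_; length; map; allFin)
open import Data.List.Extrema.Nat using (argmax; f[xs]≤f[argmax])
import Data.List.Relation.Unary.All as All
import Data.List.Relation.Unary.All.Properties as All
open import Data.List.Relation.Unary.All using (All; []; _∷_)
open import Data.List.Relation.Unary.AllPairs using ([]; _∷_)
open import Data.List.Relation.Unary.Unique.Propositional using (Unique)
import Data.List.Relation.Unary.Unique.Propositional.Properties as Unique
open import Data.List.Membership.Propositional.Properties using (∈-allFin)
open import Data.List.Properties using (length-map)
open import Data.Nat using (ℕ; zero; suc; _+_; _*_; _∸_; _⊓_; _≤_; _<_; _<ᵇ_; z≤n; s≤s)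
open import Data.Nat.Properties hiding (_≟_)
open import Data.Nat.Tactic.RingSolver using (solve-∀)
open import Data.Product using (Σ; _×_; _,_; proj₁; proj₂)
open import Function.Bundles using (_⇔_; mk⇔; Equivalence)
open import Relation.Binary.Definitions using (tri<; tri≈; tri>)
open import Relation.Binary.PropositionalEquality
open import Relation.Nullary using (Dec; yes; no; ¬_)
open import Relation.Nullary.Decidable using (⌊_⌋)

open import Defs

open import Algebra.Properties.Semiring.Sum +-*-semiring
  using (sum-syntax; ∑-distrib-+; *-distribˡ-sum; sum-replicate-zero; sum-cong-≗)

𝟙 : Bool → ℕ
𝟙 b = if b then 1 else 0

𝟙-∧ : ∀ b c → 𝟙 (b ∧ c) ≡ 𝟙 b * 𝟙 c
𝟙-∧ true  true  = refl
𝟙-∧ true  false = refl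
𝟙-∧ false c     = refl

𝟙-exclusive : ∀ {P Q : Set} (p : Dec P) (q : Dec Q) → (P → Q → ⊥) → 𝟙 ⌊ p ⌋ * 𝟙 ⌊ q ⌋ ≡ 0
𝟙-exclusive (yes p) (yes q) ¬pq = ⊥-elim (¬pq p q)
𝟙-exclusive (yes _) (no _)  _   = refl
𝟙-exclusive (no _)  _       _   = refl

∑-mono-≤ : ∀ {n} {f g : Fin n → ℕ} → (∀ i → f i ≤ g i) → ∑[ i < n ] f i ≤ ∑[ i < n ] g i
∑-mono-≤ {zero}  f≤g = z≤n
∑-mono-≤ {suc n} f≤g = +-mono-≤ (f≤g zero) (∑-mono-≤ (λ i → f≤g (suc i)))

∑-const : ∀ n c → ∑[ i < n ] c ≡ n * c
∑-const zero    c = refl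
∑-const (suc n) c = cong (c +_) (∑-const n c)

-- Not a definitional equality: ⌊_⌋ has to inspect the decision.
suc==suc : ∀ {n} (x y : Fin n) → (suc x == suc y) ≡ (x == y)
suc==suc x y with x ≟ y
... | yes _ = refl
... | no  _ = refl

∑-indicator : ∀ {n} (x : Fin n) → ∑[ y < n ] 𝟙 (x == y) ≡ 1
∑-indicator {suc n} zero    = cong suc (sum-replicate-zero n)
∑-indicator {suc n} (suc x) = trans (sum-cong-≗ (λ y → cong 𝟙 (suc==suc x y))) (∑-indicator {n} x)

∑-*-indicator : ∀ {n} m (x : Fin n) → ∑[ y < n ] (m * 𝟙 (x == y)) ≡ m
∑-*-indicator {n} m x = begin
  ∑[ y < n ] (m * 𝟙 (x == y))  ≡⟨ *-distribˡ-sum m (λ y → 𝟙 (x == y)) ⟨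
  m * ∑[ y < n ] 𝟙 (x == y)    ≡⟨ cong (m *_) (∑-indicator x) ⟩
  m * 1                        ≡⟨ *-identityʳ m ⟩
  m                            ∎
  where open ≡-Reasoning

vertex-≡ : ∀ {n} {u v : Vertex n} → a u ≡ a v → b u ≡ b v → u ≡ v
vertex-≡ {u = vtx x y p} {vtx .x .y q} refl refl = cong (vtx x y) (Finₚ.<-irrelevant p q)

module _ {n : ℕ} where

  incidence : Vertex n → Fin n → ℕ
  incidence u x = 𝟙 (a u == x) + 𝟙 (b u == x)

  degree : List (Vertex n) → Fin n → ℕ
  degree []      x = 0
  degree (u ∷ D) x = incidence u x + degree D x

  countNonNbhd : Vertex n → List (Vertex n) → ℕ
  countNonNbhd v []      = 0
  countNonNbhd v (u ∷ D) = 𝟙 (not (inClosedNbhd u v)) + countNonNbhd v D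

  multiplicity : Vertex n → List (Vertex n) → ℕ
  multiplicity v []      = 0
  multiplicity v (u ∷ D) = 𝟙 (sameV u v) + multiplicity v D

  joins : Vertex n → Fin n → Fin n → ℕ
  joins u x y = 𝟙 (a u == x) * 𝟙 (b u == y) + 𝟙 (b u == x) * 𝟙 (a u == y)

  common : Fin n → Fin n → List (Vertex n) → ℕ
  common x y []      = 0
  common x y (u ∷ D) = joins u x y + common x y D

  countNbhd+countNonNbhd≡length : (v : Vertex n) (D : List (Vertex n)) → countNbhd v D + countNonNbhd v D ≡ length D
  countNbhd+countNonNbhd≡length v []      = refl
  countNbhd+countNonNbhd≡length v (u ∷ D) with inClosedNbhd u v
  ... | true  = cong suc (countNbhd+countNonNbhd≡length v D)
  ... | false = trans (+-suc (countNbhd v D) _) (cong suc (countNbhd+countNonNbhd≡length v D))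

  isKTupleDom⇔ : ∀ {k c} (D : List (Vertex n)) → length D ≡ k + c →
                 IsKTupleDom n k D ⇔ (∀ v → countNonNbhd v D ≤ c)
  isKTupleDom⇔ {k} {c} D len = mk⇔
    (λ dom v → +-cancelˡ-≤ k _ _ (begin
      k + countNonNbhd v D              ≤⟨ +-monoˡ-≤ _ (dom v) ⟩
      countNbhd v D + countNonNbhd v D  ≡⟨ partition v ⟩
      k + c                             ∎))
    (λ bound v → +-cancelʳ-≤ c k _ (begin
      k + c                             ≡⟨ partition v ⟨
      countNbhd v D + countNonNbhd v D  ≤⟨ +-monoʳ-≤ _ (bound v) ⟩
      countNbhd v D + c                 ∎))
    where
      open ≤-Reasoning
      partition : ∀ v → countNbhd v D + countNonNbhd v D ≡ k + c
      partition v = trans (countNbhd+countNonNbhd≡length v D) len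

  -- Both sides count the common points of u and v: one when u ∉ N[v], two when u = v.
  nonNbhd+2same≡incidences : (u v : Vertex n) →
    𝟙 (not (inClosedNbhd u v)) + 2 * 𝟙 (sameV u v) ≡ incidence u (a v) + incidence u (b v)
  nonNbhd+2same≡incidences u v = count (a u ≟ a v) (a u ≟ b v) (b u ≟ a v) (b u ≟ b v)
    (λ p q → Finₚ.<⇒≢ (a<b v) (trans (sym p) q))
    (λ r s → Finₚ.<⇒≢ (a<b v) (trans (sym r) s))
    (λ p r → Finₚ.<⇒≢ (a<b u) (trans p (sym r)))
    (λ q s → Finₚ.<⇒≢ (a<b u) (trans q (sym s)))
    (λ q r → Finₚ.<-asym (subst₂ Fin._<_ q r (a<b u)) (a<b v))
    where
      count : ∀ {P Q R S : Set} (p : Dec P) (q : Dec Q) (r : Dec R) (s : Dec S) →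
        (P → Q → ⊥) → (R → S → ⊥) → (P → R → ⊥) → (Q → S → ⊥) → (Q → R → ⊥) →
        𝟙 (not ((⌊ p ⌋ ∧ ⌊ s ⌋) ∨ (not ⌊ p ⌋ ∧ not ⌊ q ⌋ ∧ not ⌊ r ⌋ ∧ not ⌊ s ⌋)))
          + 2 * 𝟙 (⌊ p ⌋ ∧ ⌊ s ⌋)
          ≡ (𝟙 ⌊ p ⌋ + 𝟙 ⌊ r ⌋) + (𝟙 ⌊ q ⌋ + 𝟙 ⌊ s ⌋)
      count (yes p) (yes q) _       _       ¬pq _   _   _   _   = ⊥-elim (¬pq p q)
      count (yes p) (no _)  (yes r) _       _   _   ¬pr _   _   = ⊥-elim (¬pr p r)
      count (yes _) (no _)  (no _)  (yes _) _   _   _   _   _   = refl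
      count (yes _) (no _)  (no _)  (no _)  _   _   _   _   _   = refl
      count (no _)  (yes q) (yes r) _       _   _   _   _   ¬qr = ⊥-elim (¬qr q r)
      count (no _)  (yes q) (no _)  (yes s) _   _   _   ¬qs _   = ⊥-elim (¬qs q s)
      count (no _)  (yes _) (no _)  (no _)  _   _   _   _   _   = refl
      count (no _)  (no _)  (yes r) (yes s) _   ¬rs _   _   _   = ⊥-elim (¬rs r s)
      count (no _)  (no _)  (yes _) (no _)  _   _   _   _   _   = refl
      count (no _)  (no _)  (no _)  (yes _) _   _   _   _   _   = refl
      count (no _)  (no _)  (no _)  (no _)  _   _   _   _   _   = refl

  isKTupleDom⇒k≤length : ∀ {k} {D : List (Vertex n)} → Vertex n → IsKTupleDom n k D → k ≤ length D
  isKTupleDom⇒k≤length {D = D} v dom = begin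
    _                                  ≤⟨ dom v ⟩
    countNbhd v D                      ≤⟨ m≤m+n _ (countNonNbhd v D) ⟩
    countNbhd v D + countNonNbhd v D   ≡⟨ countNbhd+countNonNbhd≡length v D ⟩
    length D                           ∎
    where open ≤-Reasoning

  countNonNbhd+2*multiplicity≡degrees : (v : Vertex n) (D : List (Vertex n)) →
    countNonNbhd v D + 2 * multiplicity v D ≡ degree D (a v) + degree D (b v)
  countNonNbhd+2*multiplicity≡degrees v []      = refl
  countNonNbhd+2*multiplicity≡degrees v (u ∷ D) = begin
    (miss + countNonNbhd v D) + 2 * (same + multiplicity v D)
      ≡⟨ cong ((miss + countNonNbhd v D) +_) (*-distribˡ-+ 2 same _) ⟩
    (miss + countNonNbhd v D) + (2 * same + 2 * multiplicity v D)
      ≡⟨ +-exchange miss _ _ _ ⟩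
    (miss + 2 * same) + (countNonNbhd v D + 2 * multiplicity v D)
      ≡⟨ cong₂ _+_ (nonNbhd+2same≡incidences u v) (countNonNbhd+2*multiplicity≡degrees v D) ⟩
    (incidence u (a v) + incidence u (b v)) + (degree D (a v) + degree D (b v))
      ≡⟨ +-exchange (incidence u (a v)) _ _ _ ⟩
    degree (u ∷ D) (a v) + degree (u ∷ D) (b v) ∎
    where
      open ≡-Reasoning
      miss = 𝟙 (not (inClosedNbhd u v))
      same = 𝟙 (sameV u v)
      +-exchange : ∀ p q r s → (p + q) + (r + s) ≡ (p + r) + (q + s)
      +-exchange = solve-∀

  countNonNbhd≤degrees : (v : Vertex n) (D : List (Vertex n)) → countNonNbhd v D ≤ degree D (a v) + degree D (b v)
  countNonNbhd≤degrees v D =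
    subst (countNonNbhd v D ≤_) (countNonNbhd+2*multiplicity≡degrees v D) (m≤m+n _ (2 * multiplicity v D))

  sameV⇒≡ : (u v : Vertex n) → sameV u v ≡ true → u ≡ v
  sameV⇒≡ u v same with a u ≟ a v | b u ≟ b v
  sameV⇒≡ u v _  | yes ≡a | yes ≡b = vertex-≡ ≡a ≡b
  sameV⇒≡ u v () | yes _  | no _
  sameV⇒≡ u v () | no _   | _

  multiplicity-∉ : ∀ {v} (D : List (Vertex n)) → All (v ≢_) D → multiplicity v D ≡ 0
  multiplicity-∉ []      []           = refl
  multiplicity-∉ {v} (u ∷ D) (v≢u ∷ v∉D) with sameV u v in same
  ... | true  = ⊥-elim (v≢u (sym (sameV⇒≡ u v same)))
  ... | false = multiplicity-∉ D v∉D

  multiplicity≤1 : (v : Vertex n) {D : List (Vertex n)} → Unique D → multiplicity v D ≤ 1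
  multiplicity≤1 v {[]}    []              = z≤n
  multiplicity≤1 v {u ∷ D} (u∉D ∷ unique) with sameV u v in same
  ... | true  = ≤-reflexive (cong suc (multiplicity-∉ D (subst (λ w → All (w ≢_) D) (sameV⇒≡ u v same) u∉D)))
  ... | false = multiplicity≤1 v unique

  multiplicity≡common : (v : Vertex n) (D : List (Vertex n)) → multiplicity v D ≡ common (a v) (b v) D
  multiplicity≡common v []      = refl
  multiplicity≡common v (u ∷ D) = cong₂ _+_ sameV≡joins (multiplicity≡common v D)
    where
      sameV≡joins : 𝟙 (sameV u v) ≡ joins u (a v) (b v)
      sameV≡joins = begin
        𝟙 (sameV u v)                        ≡⟨ 𝟙-∧ (a u == a v) (b u == b v) ⟩
        straight                             ≡⟨ +-identityʳ straight ⟨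
        straight + 0                         ≡⟨ cong (straight +_) (𝟙-exclusive (b u ≟ a v) (a u ≟ b v) crossed) ⟨
        joins u (a v) (b v)                  ∎
        where
          open ≡-Reasoning
          straight = 𝟙 (a u == a v) * 𝟙 (b u == b v)
          crossed : b u ≡ a v → a u ≡ b v → ⊥
          crossed r q = Finₚ.<-asym (subst₂ Fin._<_ q r (a<b u)) (a<b v)

  common-sym : (x y : Fin n) (D : List (Vertex n)) → common x y D ≡ common y x D
  common-sym x y []      = refl
  common-sym x y (u ∷ D) = cong₂ _+_ joins-sym (common-sym x y D)
    where
      joins-sym : joins u x y ≡ joins u y x
      joins-sym = trans (+-comm (𝟙 (a u == x) * 𝟙 (b u == y)) _)
                        (cong₂ _+_ (*-comm (𝟙 (b u == x)) _) (*-comm (𝟙 (a u == x)) _))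

  ∑joins≡incidence : (u : Vertex n) (x : Fin n) → ∑[ y < n ] joins u x y ≡ incidence u x
  ∑joins≡incidence u x = begin
    ∑[ y < n ] (𝟙 (a u == x) * 𝟙 (b u == y) + 𝟙 (b u == x) * 𝟙 (a u == y))
      ≡⟨ ∑-distrib-+ (λ y → 𝟙 (a u == x) * 𝟙 (b u == y)) (λ y → 𝟙 (b u == x) * 𝟙 (a u == y)) ⟩
    ∑[ y < n ] (𝟙 (a u == x) * 𝟙 (b u == y)) + ∑[ y < n ] (𝟙 (b u == x) * 𝟙 (a u == y))
      ≡⟨ cong₂ _+_ (∑-*-indicator (𝟙 (a u == x)) (b u)) (∑-*-indicator (𝟙 (b u == x)) (a u)) ⟩
    incidence u x ∎
    where open ≡-Reasoning

  ∑common≡degree : (x : Fin n) (D : List (Vertex n)) → ∑[ y < n ] common x y D ≡ degree D x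
  ∑common≡degree x []      = sum-replicate-zero n
  ∑common≡degree x (u ∷ D) = begin
    ∑[ y < n ] (joins u x y + common x y D)
      ≡⟨ ∑-distrib-+ (joins u x) (λ y → common x y D) ⟩
    ∑[ y < n ] joins u x y + ∑[ y < n ] common x y D
      ≡⟨ cong₂ _+_ (∑joins≡incidence u x) (∑common≡degree x D) ⟩
    incidence u x + degree D x ∎
    where open ≡-Reasoning

  ∑degree≡2*length : (D : List (Vertex n)) → ∑[ x < n ] degree D x ≡ 2 * length D
  ∑degree≡2*length []      = sum-replicate-zero n
  ∑degree≡2*length (u ∷ D) = begin
    ∑[ x < n ] (incidence u x + degree D x)            ≡⟨ ∑-distrib-+ (incidence u) (degree D) ⟩
    ∑[ x < n ] incidence u x + ∑[ x < n ] degree D x   ≡⟨ cong₂ _+_ ∑incidence≡2 (∑degree≡2*length D) ⟩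
    2 + 2 * length D                                   ≡⟨ *-suc 2 (length D) ⟨
    2 * length (u ∷ D)                                 ∎
    where
      open ≡-Reasoning
      ∑incidence≡2 : ∑[ x < n ] incidence u x ≡ 2
      ∑incidence≡2 = trans (∑-distrib-+ (λ x → 𝟙 (a u == x)) (λ x → 𝟙 (b u == x)))
                           (cong₂ _+_ (∑-indicator (a u)) (∑-indicator (b u)))

pair-elim : ∀ {n} (P : Fin n → Fin n → Set) → (∀ {x y} → P x y → P y x) →
            (∀ v → P (a v) (b v)) → ∀ {x y} → x ≢ y → P x y
pair-elim P swap P-vertex {x} {y} x≢y with Finₚ.<-cmp x y
... | tri< x<y _   _   = P-vertex (vtx x y x<y)
... | tri≈ _   x≡y _   = ⊥-elim (x≢y x≡y)
... | tri> _   _   y<x = swap (P-vertex (vtx y x y<x))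

-- For a point of maximum degree Δ, lo bounds the degree of any other point not joined to it by an
-- edge of D, and hi the degree of one that is.
lo hi : ℕ → ℕ → ℕ
lo c Δ = (c ∸ Δ) ⊓ Δ
hi c Δ = Δ ⊓ ((c + 2) ∸ Δ)

lo≤hi : ∀ c Δ → lo c Δ ≤ hi c Δ
lo≤hi c Δ = ⊓-glb (m⊓n≤n (c ∸ Δ) Δ) (≤-trans (m⊓n≤m (c ∸ Δ) Δ) (∸-monoˡ-≤ Δ (m≤m+n c 2)))

degree-bound : ∀ c Δ d s → s ≤ 1 → Δ + d ≤ c + 2 * s → d ≤ Δ → d ≤ lo c Δ + (hi c Δ ∸ lo c Δ) * s
degree-bound c Δ d 0 _ Δ+d≤c d≤Δ
  rewrite *-zeroʳ (hi c Δ ∸ lo c Δ) | +-identityʳ (lo c Δ) | +-identityʳ c =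
  ⊓-glb (m+n≤o⇒m≤o∸n d (subst (_≤ c) (+-comm Δ d) Δ+d≤c)) d≤Δ
degree-bound c Δ d 1 _ Δ+d≤c+2 d≤Δ
  rewrite *-identityʳ (hi c Δ ∸ lo c Δ) | m+[n∸m]≡n (lo≤hi c Δ) =
  ⊓-glb d≤Δ (m+n≤o⇒m≤o∸n d (subst (_≤ c + 2) (+-comm Δ d) Δ+d≤c+2))
degree-bound c Δ d (suc (suc s)) (s≤s ()) _ _

CountingInequality : (k c N Δ : ℕ) → Set
CountingInequality k c N Δ = 2 * (k + c) + lo c Δ ≤ lo c Δ * N + ((hi c Δ ∸ lo c Δ) * Δ + Δ)

refute : ∀ {m n} → m ≤ n → {_ : T (n <ᵇ m)} → ⊥
refute {m} {n} m≤n {n<m} = <⇒≱ (<ᵇ⇒< n m n<m) m≤n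

counting-lo≡0 : ∀ {k c N R} → 2 ≤ k → 2 * (k + c) + 0 ≤ 0 * N + R → 2 * (2 + c) ≤ R
counting-lo≡0 {k} {c} hk h = begin
  2 * (2 + c)      ≤⟨ *-monoʳ-≤ 2 (+-monoˡ-≤ c hk) ⟩
  2 * (k + c)      ≤⟨ m≤m+n (2 * (k + c)) 0 ⟩
  2 * (k + c) + 0  ≤⟨ h ⟩
  _                ∎
  where open ≤-Reasoning

counting-lo≡1 : ∀ {k c N R} → N + c ≤ 2 * k + 5 → 2 * (k + c) + 1 ≤ 1 * N + R → 3 * c + 1 ≤ 5 + R
counting-lo≡1 {k} {c} {N} {R} hN h = +-cancelˡ-≤ (2 * k) _ _ (begin
  2 * k + (3 * c + 1)    ≡⟨ lhs k c ⟩
  2 * (k + c) + 1 + c    ≤⟨ +-monoˡ-≤ c h ⟩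
  1 * N + R + c          ≡⟨ middle N R c ⟩
  N + c + R              ≤⟨ +-monoˡ-≤ R hN ⟩
  2 * k + 5 + R          ≡⟨ +-assoc (2 * k) 5 R ⟩
  2 * k + (5 + R)        ∎)
  where
    open ≤-Reasoning
    lhs : ∀ k c → 2 * k + (3 * c + 1) ≡ 2 * (k + c) + 1 + c
    lhs = solve-∀
    middle : ∀ N R c → 1 * N + R + c ≡ N + c + R
    middle = solve-∀

-- For c ≤ 3 and Δ ≤ c + 2 one has lo c Δ ≤ 1, and in each case the inequality collapses to a false
-- statement about numerals.
counting-infeasible : ∀ {k N} c Δ → 2 ≤ k → N + c ≤ 2 * k + 5 → c ≤ 3 → Δ ≤ c + 2 →
                      ¬ CountingInequality k c N Δ
counting-infeasible {k} {N} 0 0 hk _  _ _ h = refute (counting-lo≡0 {k} {0} {N} hk h)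
counting-infeasible {k} {N} 0 1 hk _  _ _ h = refute (counting-lo≡0 {k} {0} {N} hk h)
counting-infeasible {k} {N} 0 2 hk _  _ _ h = refute (counting-lo≡0 {k} {0} {N} hk h)
counting-infeasible {k} {N} 1 0 hk _  _ _ h = refute (counting-lo≡0 {k} {1} {N} hk h)
counting-infeasible {k} {N} 1 1 hk _  _ _ h = refute (counting-lo≡0 {k} {1} {N} hk h)
counting-infeasible {k} {N} 1 2 hk _  _ _ h = refute (counting-lo≡0 {k} {1} {N} hk h)
counting-infeasible {k} {N} 1 3 hk _  _ _ h = refute (counting-lo≡0 {k} {1} {N} hk h)
counting-infeasible {k} {N} 2 0 hk _  _ _ h = refute (counting-lo≡0 {k} {2} {N} hk h)
counting-infeasible {k} {N} 2 1 _  hN _ _ h = refute (counting-lo≡1 {k} {2} {N} hN h)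
counting-infeasible {k} {N} 2 2 hk _  _ _ h = refute (counting-lo≡0 {k} {2} {N} hk h)
counting-infeasible {k} {N} 2 3 hk _  _ _ h = refute (counting-lo≡0 {k} {2} {N} hk h)
counting-infeasible {k} {N} 2 4 hk _  _ _ h = refute (counting-lo≡0 {k} {2} {N} hk h)
counting-infeasible {k} {N} 3 0 hk _  _ _ h = refute (counting-lo≡0 {k} {3} {N} hk h)
counting-infeasible {k} {N} 3 1 _  hN _ _ h = refute (counting-lo≡1 {k} {3} {N} hN h)
counting-infeasible {k} {N} 3 2 _  hN _ _ h = refute (counting-lo≡1 {k} {3} {N} hN h)
counting-infeasible {k} {N} 3 3 hk _  _ _ h = refute (counting-lo≡0 {k} {3} {N} hk h)
counting-infeasible {k} {N} 3 4 hk _  _ _ h = refute (counting-lo≡0 {k} {3} {N} hk h)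
counting-infeasible {k} {N} 3 5 hk _  _ _ h = refute (counting-lo≡0 {k} {3} {N} hk h)
counting-infeasible 0 (suc (suc (suc _))) _ _ _ (s≤s (s≤s ()))
counting-infeasible 1 (suc (suc (suc (suc _)))) _ _ _ (s≤s (s≤s (s≤s ())))
counting-infeasible 2 (suc (suc (suc (suc (suc _))))) _ _ _ (s≤s (s≤s (s≤s (s≤s ()))))
counting-infeasible 3 (suc (suc (suc (suc (suc (suc _)))))) _ _ _ (s≤s (s≤s (s≤s (s≤s (s≤s ())))))
counting-infeasible (suc (suc (suc (suc _)))) _ _ _ (s≤s (s≤s (s≤s ()))) _

maximum-point : ∀ {n} (f : Fin (suc n) → ℕ) → Σ (Fin (suc n)) λ x → ∀ y → f y ≤ f x
maximum-point {n} f = argmax f 0F (allFin (suc n)) , λ y →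
  All.lookup (f[xs]≤f[argmax] {f = f} 0F (allFin (suc n))) (∈-allFin y)

module MaximumDegree {n k c : ℕ} {D : List (Vertex (2 + n))}
  (unique : Unique D) (dom : IsKTupleDom (2 + n) k D) (len : length D ≡ k + c)
  (x₀ : Fin (2 + n)) (degree≤Δ : ∀ y → degree D y ≤ degree D x₀) where

  PairBound : Fin (2 + n) → Fin (2 + n) → Set
  PairBound x y = degree D x + degree D y ≤ c + 2 * common x y D × common x y D ≤ 1

  pairBound : ∀ {x y} → x ≢ y → PairBound x y
  pairBound = pair-elim PairBound swap onVertex
    where
      swap : ∀ {x y} → PairBound x y → PairBound y x
      swap {x} {y} (sum≤ , common≤1) =
        subst₂ (λ s t → s ≤ c + 2 * t) (+-comm (degree D x) _) (common-sym x y D) sum≤ ,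
        subst (_≤ 1) (common-sym x y D) common≤1
      onVertex : ∀ v → PairBound (a v) (b v)
      onVertex v rewrite sym (multiplicity≡common v D) =
        (begin
          degree D (a v) + degree D (b v)                ≡⟨ countNonNbhd+2*multiplicity≡degrees v D ⟨
          countNonNbhd v D + 2 * multiplicity v D        ≤⟨ +-monoˡ-≤ _ (Equivalence.to (isKTupleDom⇔ D len) dom v) ⟩
          c + 2 * multiplicity v D                       ∎) ,
        multiplicity≤1 v unique
        where open ≤-Reasoning

  Δ : ℕ
  Δ = degree D x₀

  Δ≤c+2 : Δ ≤ c + 2
  Δ≤c+2 = begin
    Δ                        ≤⟨ m≤m+n Δ (degree D y) ⟩
    Δ + degree D y           ≤⟨ proj₁ (pairBound x₀≢y) ⟩
    c + 2 * common x₀ y D    ≤⟨ +-monoʳ-≤ c (*-monoʳ-≤ 2 (proj₂ (pairBound x₀≢y))) ⟩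
    c + 2                    ∎
    where
      open ≤-Reasoning
      other : (x : Fin (2 + n)) → Σ (Fin (2 + n)) (x ≢_)
      other 0F      = 1F , λ ()
      other (suc _) = 0F , λ ()
      y = proj₁ (other x₀)
      x₀≢y = proj₂ (other x₀)

  hi∸lo : ℕ
  hi∸lo = hi c Δ ∸ lo c Δ

  pointwise : ∀ y → degree D y + lo c Δ * 𝟙 (x₀ == y) ≤ lo c Δ + hi∸lo * common x₀ y D + Δ * 𝟙 (x₀ == y)
  pointwise y with x₀ ≟ y
  ... | yes refl = begin
    Δ + lo c Δ * 1                          ≡⟨ shuffle Δ (lo c Δ) ⟩
    lo c Δ + 0 + Δ * 1                      ≤⟨ +-monoˡ-≤ (Δ * 1) (+-monoʳ-≤ (lo c Δ) z≤n) ⟩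
    lo c Δ + hi∸lo * common x₀ x₀ D + Δ * 1     ∎
    where
      open ≤-Reasoning
      shuffle : ∀ Δ l → Δ + l * 1 ≡ l + 0 + Δ * 1
      shuffle = solve-∀
  ... | no x₀≢y = begin
    degree D y + lo c Δ * 0                 ≡⟨ +*0 (degree D y) (lo c Δ) ⟩
    degree D y                              ≤⟨ degree-bound c Δ (degree D y) _ common≤1 sum≤ (degree≤Δ y) ⟩
    lo c Δ + hi∸lo * common x₀ y D              ≡⟨ +*0 _ Δ ⟨
    lo c Δ + hi∸lo * common x₀ y D + Δ * 0      ∎
    where
      open ≤-Reasoning
      +*0 : ∀ m n → m + n * 0 ≡ m
      +*0 = solve-∀
      sum≤ = proj₁ (pairBound x₀≢y)
      common≤1 = proj₂ (pairBound x₀≢y)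

  counting : CountingInequality k c (2 + n) Δ
  counting = begin
    2 * (k + c) + l                                    ≡⟨ cong₂ (λ m s → 2 * m + s) len (∑-*-indicator l x₀) ⟨
    2 * length D + ∑[ y < N ] (l * δ y)                ≡⟨ cong (_+ ∑[ y < N ] (l * δ y)) (∑degree≡2*length D) ⟨
    ∑[ y < N ] degree D y + ∑[ y < N ] (l * δ y)       ≡⟨ ∑-distrib-+ (degree D) (λ y → l * δ y) ⟨
    ∑[ y < N ] (degree D y + l * δ y)                  ≤⟨ ∑-mono-≤ pointwise ⟩
    ∑[ y < N ] (l + hi∸lo * common x₀ y D + Δ * δ y)
      ≡⟨ ∑-distrib-+ (λ y → l + hi∸lo * common x₀ y D) (λ y → Δ * δ y) ⟩
    ∑[ y < N ] (l + hi∸lo * common x₀ y D) + ∑[ y < N ] (Δ * δ y)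
      ≡⟨ cong₂ _+_ (∑-distrib-+ (λ _ → l) (λ y → hi∸lo * common x₀ y D)) (∑-*-indicator Δ x₀) ⟩
    ∑[ y < N ] l + ∑[ y < N ] (hi∸lo * common x₀ y D) + Δ
      ≡⟨ cong (λ s → ∑[ y < N ] l + s + Δ) (*-distribˡ-sum hi∸lo (λ y → common x₀ y D)) ⟨
    ∑[ y < N ] l + hi∸lo * ∑[ y < N ] common x₀ y D + Δ
      ≡⟨ cong₂ (λ m s → m + hi∸lo * s + Δ) (trans (∑-const N l) (*-comm N l)) (∑common≡degree x₀ D) ⟩
    l * N + hi∸lo * Δ + Δ                                  ≡⟨ +-assoc (l * N) (hi∸lo * Δ) Δ ⟩
    l * N + (hi∸lo * Δ + Δ)                                ∎
    where
      open ≤-Reasoning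
      N = 2 + n
      l = lo c Δ
      δ : Fin N → ℕ
      δ y = 𝟙 (x₀ == y)

no-kTupleDom-of-size : ∀ {n k c} {D : List (Vertex (2 + n))} → 2 ≤ k → c ≤ 3 → 2 + n + c ≤ 2 * k + 5 →
                       Unique D → IsKTupleDom (2 + n) k D → length D ≢ k + c
no-kTupleDom-of-size {n} {k} {c} {D} hk hc hn unique dom len =
  counting-infeasible {k} {2 + n} c Δ hk hn hc Δ≤c+2 counting
  where open MaximumDegree unique dom len (proj₁ (maximum-point (degree D))) (proj₂ (maximum-point (degree D)))

k+3≤length : ∀ {n k} {D : List (Vertex (2 + n))} → 2 ≤ k → 2 + n ≡ 2 * k + 3 →
             Unique D → IsKTupleDom (2 + n) k D → k + 3 ≤ length D
k+3≤length {n} {k} {D} hk hn unique dom = ≮⇒≥ λ length<k+3 →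
  let c≤2 = m≤n+o⇒m∸n≤o (length D) k (≤-pred (subst (length D <_) (+-suc k 2) length<k+3))
  in no-kTupleDom-of-size hk (≤-trans c≤2 (n≤1+n 2)) (n+c≤2k+5 c≤2) unique dom (sym (m+[n∸m]≡n k≤length))
  where
    k≤length : k ≤ length D
    k≤length = isKTupleDom⇒k≤length {D = D} (vtx 0F 1F (s≤s z≤n)) dom
    n+c≤2k+5 : ∀ {c} → c ≤ 2 → 2 + n + c ≤ 2 * k + 5
    n+c≤2k+5 {c} c≤2 = begin
      2 + n + c        ≤⟨ +-mono-≤ (≤-reflexive hn) c≤2 ⟩
      2 * k + 3 + 2    ≡⟨ +-assoc (2 * k) 3 2 ⟩
      2 * k + 5        ∎
      where open ≤-Reasoning

no-kTupleDom-of-size-k+3 : ∀ {n k} {D : List (Vertex (2 + n))} → 2 ≤ k → 2 + n < 2 * k + 3 →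
                           Unique D → IsKTupleDom (2 + n) k D → length D ≢ k + 3
no-kTupleDom-of-size-k+3 {n} {k} hk n<2k+3 = no-kTupleDom-of-size hk ≤-refl (begin
  2 + n + 3        ≤⟨ +-monoˡ-≤ 3 (≤-pred (subst (2 + n <_) (+-suc (2 * k) 2) n<2k+3)) ⟩
  2 * k + 2 + 3    ≡⟨ +-assoc (2 * k) 2 3 ⟩
  2 * k + 5        ∎)
  where open ≤-Reasoning

HasKTupleDomOfSize : (n k m : ℕ) → Set
HasKTupleDomOfSize n k m = Σ (List (Vertex n)) (λ D → Unique D × IsKTupleDom n k D × length D ≡ m)

KTupleDomNumberIs⇒≤ : ∀ {n k m m′} → KTupleDomNumberIs n k m → HasKTupleDomOfSize n k m′ → m ≤ m′
KTupleDomNumberIs⇒≤ (_ , minimal) (D , unique , dom , len) = subst (_ ≤_) len (minimal D unique dom)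

module _ {n : ℕ} where

  shiftV : Vertex n → Vertex (suc n)
  shiftV u = vtx (suc (a u)) (suc (b u)) (s≤s (a<b u))

  shift : List (Vertex n) → List (Vertex (suc n))
  shift = map shiftV

  degree-shift-zero : (D : List (Vertex n)) → degree (shift D) 0F ≡ 0
  degree-shift-zero []      = refl
  degree-shift-zero (u ∷ D) = degree-shift-zero D

  degree-shift-suc : (D : List (Vertex n)) (x : Fin n) → degree (shift D) (suc x) ≡ degree D x
  degree-shift-suc []      x = refl
  degree-shift-suc (u ∷ D) x =
    cong₂ _+_ (cong₂ _+_ (cong 𝟙 (suc==suc (a u) x)) (cong 𝟙 (suc==suc (b u) x))) (degree-shift-suc D x)

  shift-unique : {D : List (Vertex n)} → Unique D → Unique (shift D)
  shift-unique = Unique.map⁺ λ {u} {v} eq →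
    vertex-≡ (Finₚ.suc-injective (cong a eq)) (Finₚ.suc-injective (cong b eq))

  length-shift : (D : List (Vertex n)) → length (shift D) ≡ length D
  length-shift = length-map shiftV

-- The pairs {0,1}, {2,3}, …, {2L-2,2L-1}; indexing by L * 2 + m makes each pair add two points definitionally.
matching : (L : ℕ) {m : ℕ} → List (Vertex (L * 2 + m))
matching zero    = []
matching (suc L) = vtx 0F 1F (s≤s z≤n) ∷ shift (shift (matching L))

degree-matching≤1 : ∀ L {m} (x : Fin (L * 2 + m)) → degree (matching L) x ≤ 1
degree-matching≤1 zero          x             = z≤n
degree-matching≤1 (suc L) {m}   0F            = ≤-reflexive (cong suc (degree-shift-zero (shift (matching L {m}))))
degree-matching≤1 (suc L) {m}   1F            =
  ≤-reflexive (cong suc (trans (degree-shift-suc (shift (matching L {m})) 0F) (degree-shift-zero (matching L))))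
degree-matching≤1 (suc L) {m}   (suc (suc x)) = begin
  degree (shift (shift (matching L))) (suc (suc x))  ≡⟨ degree-shift-suc (shift (matching L {m})) (suc x) ⟩
  degree (shift (matching L)) (suc x)                ≡⟨ degree-shift-suc (matching L {m}) x ⟩
  degree (matching L) x                              ≤⟨ degree-matching≤1 L x ⟩
  1                                                  ∎
  where open ≤-Reasoning

matching-unique : ∀ L {m} → Unique (matching L {m})
matching-unique zero    = []
matching-unique (suc L) =
  All.map⁺ (All.map⁺ (All.universal (λ _ ()) (matching L))) ∷ shift-unique (shift-unique (matching-unique L))

length-matching : ∀ L {m} → length (matching L {m}) ≡ L
length-matching zero        = refl
length-matching (suc L) {m} =
  cong suc (trans (length-shift (shift (matching L {m}))) (trans (length-shift (matching L)) (length-matching L)))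

matching-isKTupleDom : ∀ k {m} → IsKTupleDom ((k + 2) * 2 + m) k (matching (k + 2))
matching-isKTupleDom k = Equivalence.from (isKTupleDom⇔ (matching (k + 2)) (length-matching (k + 2))) λ v →
  ≤-trans (countNonNbhd≤degrees v (matching (k + 2)))
          (+-mono-≤ (degree-matching≤1 (k + 2) (a v)) (degree-matching≤1 (k + 2) (b v)))

triangleMatching : (L : ℕ) {m : ℕ} → List (Vertex (3 + (L * 2 + m)))
triangleMatching L = vtx 0F 1F (s≤s z≤n) ∷ vtx 0F 2F (s≤s z≤n) ∷ vtx 1F 2F (s≤s (s≤s z≤n))
                   ∷ shift (shift (shift (matching L)))

module _ (L : ℕ) {m : ℕ} where
  private
    M = matching L {m}
    D = triangleMatching L {m}

  degree-triangleMatching-outside≤1 : ∀ y → degree D (suc (suc (suc y))) ≤ 1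
  degree-triangleMatching-outside≤1 y = begin
    degree (shift (shift (shift M))) (suc (suc (suc y)))  ≡⟨ degree-shift-suc (shift (shift M)) (suc (suc y)) ⟩
    degree (shift (shift M)) (suc (suc y))                ≡⟨ degree-shift-suc (shift M) (suc y) ⟩
    degree (shift M) (suc y)                              ≡⟨ degree-shift-suc M y ⟩
    degree M y                                            ≤⟨ degree-matching≤1 L y ⟩
    1                                                     ∎
    where open ≤-Reasoning

  degree-triangleMatching≤2 : ∀ x → degree D x ≤ 2
  degree-triangleMatching≤2 0F = ≤-reflexive (cong (2 +_) (degree-shift-zero (shift (shift M))))
  degree-triangleMatching≤2 1F = ≤-reflexive (cong (2 +_)
    (trans (degree-shift-suc (shift (shift M)) 0F) (degree-shift-zero (shift M))))
  degree-triangleMatching≤2 2F = ≤-reflexive (cong (2 +_)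
    (trans (degree-shift-suc (shift (shift M)) 1F)
      (trans (degree-shift-suc (shift M) 0F) (degree-shift-zero M))))
  degree-triangleMatching≤2 (suc (suc (suc y))) =
    ≤-trans (degree-triangleMatching-outside≤1 y) (n≤1+n 1)

  triangleMatching-unique : Unique D
  triangleMatching-unique =
      ((λ ()) ∷ (λ ()) ∷ avoids (λ _ ())) ∷ ((λ ()) ∷ avoids (λ _ ())) ∷ avoids (λ _ ())
    ∷ shift-unique (shift-unique (shift-unique (matching-unique L)))
    where
      avoids : ∀ {t} → (∀ u → t ≢ shiftV (shiftV (shiftV u))) → All (t ≢_) (shift (shift (shift M)))
      avoids t≢u = All.map⁺ (All.map⁺ (All.map⁺ (All.universal t≢u M)))

  length-triangleMatching : length D ≡ L + 3
  length-triangleMatching = begin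
    3 + length (shift (shift (shift M)))   ≡⟨ cong (3 +_) (length-shift (shift (shift M))) ⟩
    3 + length (shift (shift M))           ≡⟨ cong (3 +_) (length-shift (shift M)) ⟩
    3 + length (shift M)                   ≡⟨ cong (3 +_) (length-shift M) ⟩
    3 + length M                           ≡⟨ cong (3 +_) (length-matching L) ⟩
    3 + L                                  ≡⟨ +-comm 3 L ⟩
    L + 3                                  ∎
    where open ≡-Reasoning

  triangleMatching-isKTupleDom : IsKTupleDom (3 + (L * 2 + m)) L D
  triangleMatching-isKTupleDom = Equivalence.from (isKTupleDom⇔ D length-triangleMatching) bound
    where
      edgeOfD : ∀ v → 1 ≤ multiplicity v D → countNonNbhd v D ≤ 3
      edgeOfD v 1≤mult = ≤-trans (+-cancelʳ-≤ 2 _ 2 (begin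
        countNonNbhd v D + 2                      ≤⟨ +-monoʳ-≤ _ (*-monoʳ-≤ 2 1≤mult) ⟩
        countNonNbhd v D + 2 * multiplicity v D   ≡⟨ countNonNbhd+2*multiplicity≡degrees v D ⟩
        degree D (a v) + degree D (b v)
          ≤⟨ +-mono-≤ (degree-triangleMatching≤2 (a v)) (degree-triangleMatching≤2 (b v)) ⟩
        2 + 2                                     ∎)) (n≤1+n 2)
        where open ≤-Reasoning
      bound : ∀ v → countNonNbhd v D ≤ 3
      bound v@(vtx x (suc (suc (suc y))) _) = ≤-trans (countNonNbhd≤degrees v D)
        (+-mono-≤ (degree-triangleMatching≤2 x) (degree-triangleMatching-outside≤1 y))
      bound v@(vtx 0F 1F _) = edgeOfD v (s≤s z≤n)
      bound v@(vtx 0F 2F _) = edgeOfD v (s≤s z≤n)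
      bound v@(vtx 1F 2F _) = edgeOfD v (s≤s z≤n)
      bound (vtx _ 0F ())
      bound (vtx (suc _) 1F (s≤s ()))
      bound (vtx (suc (suc _)) 2F (s≤s (s≤s ())))

matching-kTupleDom : ∀ {n k} → 2 * k + 3 < n → HasKTupleDomOfSize n k (k + 2)
matching-kTupleDom {n} {k} 2k+3<n = subst (λ N → HasKTupleDomOfSize N k (k + 2)) (m+[n∸m]≡n fits)
  (matching (k + 2) , matching-unique (k + 2) , matching-isKTupleDom k , length-matching (k + 2))
  where
    size : ∀ k → suc (2 * k + 3) ≡ (k + 2) * 2
    size = solve-∀
    fits : (k + 2) * 2 ≤ n
    fits = subst (_≤ n) (size k) 2k+3<n

triangleMatching-kTupleDom : ∀ {n k} → n ≡ 2 * k + 3 → HasKTupleDomOfSize n k (k + 3)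
triangleMatching-kTupleDom {n} {k} n≡2k+3 = subst (λ N → HasKTupleDomOfSize N k (k + 3)) (trans (size k) (sym n≡2k+3))
  (triangleMatching k , triangleMatching-unique k , triangleMatching-isKTupleDom k , length-triangleMatching k)
  where
    size : ∀ k → 3 + (k * 2 + 0) ≡ 2 * k + 3
    size = solve-∀

theorem20 : (k n : ℕ) → 2 ≤ k → 5 ≤ n → KTupleDefined n k →
    (KTupleDomNumberIs n k (k + 3) ⇔ n ≡ 2 * k + 3)
theorem20 k (suc (suc n)) hk _ _ = mk⇔ to from
  where
    to : KTupleDomNumberIs (2 + n) k (k + 3) → 2 + n ≡ 2 * k + 3
    to γ@((_ , unique , dom , len) , _) with <-cmp (2 + n) (2 * k + 3)
    ... | tri< n<2k+3 _ _ = ⊥-elim (no-kTupleDom-of-size-k+3 hk n<2k+3 unique dom len)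
    ... | tri≈ _ n≡2k+3 _ = n≡2k+3
    ... | tri> _ _ 2k+3<n = ⊥-elim (refute (+-cancelˡ-≤ k 3 2 (KTupleDomNumberIs⇒≤ γ (matching-kTupleDom 2k+3<n))))
    from : 2 + n ≡ 2 * k + 3 → KTupleDomNumberIs (2 + n) k (k + 3)
    from n≡2k+3 = triangleMatching-kTupleDom n≡2k+3 , λ _ unique dom → k+3≤length hk n≡2k+3 unique dom
theorem20 k 1 _ (s≤s ()) _
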